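{- The Hurwitz quaternion $7$ cannot be written in the form $7=UR^2$ with $U$ a unit of $Q_{\mathrm{Hur}}$ and $R\in Q_{\mathrm{Hur}}$, even though its norm $49$ is a perfect square.
   Context: Quaternions are elements $a+bi+cj+dk$ with $a,b,c,d\in\mathbb{R}$ and $i^2=j^2=k^2=ijk=-1$. The Hurwitz order $Q_{\mathrm{Hur}}$ is the set of quaternions with $a,b,c,d$ all in $\mathbb{Z}$ or all in $\mathbb{Z}+\tfrac12$; the norm is $\mathrm{Norm}(a+bi+cj+dk)=a^2+b^2+c^2+d^2$. Units are the elements of norm 1. -}

module Defs where

open import Data.Integer using (ℤ; +_; _+_; _-_; _*_)
open import Data.Integer.Divisibility using (_∣_)
open import Data.Product using (_×_; _,_)
open import Data.Sum using (_⊎_)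
open import Relation.Binary.PropositionalEquality using (_≡_)

record ℍℤ : Set where
  constructor ⟨_,_,_,_⟩
  field
    re im-i im-j im-k : ℤ
open ℍℤ public

-- Hamilton product (i² = j² = k² = ijk = -1).
infixl 7 _·_
_·_ : ℍℤ → ℍℤ → ℍℤ
⟨ a₁ , b₁ , c₁ , d₁ ⟩ · ⟨ a₂ , b₂ , c₂ , d₂ ⟩ =
  ⟨ a₁ * a₂ - b₁ * b₂ - c₁ * c₂ - d₁ * d₂
  , a₁ * b₂ + b₁ * a₂ + c₁ * d₂ - d₁ * c₂
  , a₁ * c₂ - b₁ * d₂ + c₁ * a₂ + d₁ * b₂
  , a₁ * d₂ + b₁ * c₂ - c₁ * b₂ + d₁ * a₂ ⟩

scale : ℤ → ℍℤ → ℍℤ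
scale n ⟨ a , b , c , d ⟩ = ⟨ n * a , n * b , n * c , n * d ⟩

norm : ℍℤ → ℤ
norm ⟨ a , b , c , d ⟩ = a * a + b * b + c * c + d * d

Even Odd : ℤ → Set
Even x = + 2 ∣ x
Odd x = Even (x + + 1)

-- Hurwitz quaternions are represented by their DOUBLES:
-- q = (A + B i + C j + D k)/2 lies in Q_Hur iff A, B, C, D ∈ ℤ are all even
-- (q has integer coordinates) or all odd (q has half-integer coordinates).
IsHurwitzDouble : ℍℤ → Set
IsHurwitzDouble ⟨ a , b , c , d ⟩ =
  (Even a × Even b × Even c × Even d) ⊎ (Odd a × Odd b × Odd c × Odd d)

-- For doubles u = 2U, r = 2R of Hurwitz quaternions, U · R · R = q
-- iff u · r · r = 8 q, i.e. the exact equation computed on doubles.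
-- U is a unit iff Norm U = 1 iff norm u = 4.
IsUnitDouble : ℍℤ → Set
IsUnitDouble u = IsHurwitzDouble u × norm u ≡ + 4

{-# OPTIONS --safe #-}
module Submission where

-- Pass to doubles u = 2U, r = 2R, so that u r r = 56 with N(u) = 4. Multiplicativity
-- of the norm gives N(u) N(r)² = 56², hence N(r) = 28. Multiplying u r² = 56 on the left
-- by the conjugate of u gives 4 r² = 56 ū; comparing real parts, with
-- Re(r²) = 2 Re(r)² − N(r), yields Re(r)² = 7 (2 + Re u). So 7 divides Re(r)² ≤ 28,
-- forcing Re(r) = 0 and 28 = b² + c² + d²; but 28 = 4 · 7 is not a sum of three squares.

open import Defs
open import Data.Integer using (ℤ; +_)
open import Data.Product using (Σ; _×_; _,_)
open import Data.Empty using (⊥)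
open import Relation.Binary.PropositionalEquality
  using (_≡_; refl; sym; trans; cong; cong₂; module ≡-Reasoning)
open import Relation.Nullary using (¬_)

module SumsOfSquares where
  open import Data.Nat using (_+_; _*_; _<_; _≤_; _≤?_; _≟_)
  open import Data.Nat.Divisibility using (_∣_; _∣?_)
  open import Data.Nat.Properties
    using ( <-cmp; <⇒≢; >⇒≢; ≰⇒>; *-mono-<; *-mono-≤; ≤-trans; ≤-reflexive
          ; m≤m+n; m≤n+m; allUpTo?)
  open import Relation.Binary.Definitions using (tri<; tri≈; tri>)
  open import Relation.Binary.PropositionalEquality using (_≢_; subst)
  open import Relation.Nullary using (contradiction)
  open import Relation.Nullary.Decidable using (toWitness; from-no; ¬?; _→-dec_)

  square-injective : ∀ {m n} → m * m ≡ n * n → m ≡ n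
  square-injective {m} {n} m²≡n² with <-cmp m n
  ... | tri< m<n _ _ = contradiction m²≡n² (<⇒≢ (*-mono-< m<n m<n))
  ... | tri≈ _ m≡n _ = m≡n
  ... | tri> _ _ m>n = contradiction m²≡n² (>⇒≢ (*-mono-< m>n m>n))

  square≤28⇒<6 : ∀ {x} → x * x ≤ 28 → x < 6
  square≤28⇒<6 x²≤28 = ≰⇒> λ 6≤x → from-no (36 ≤? 28) (≤-trans (*-mono-≤ 6≤x 6≤x) x²≤28)

  7∣square≤28⇒≡0 : ∀ {a} → a * a ≤ 28 → 7 ∣ a * a → a ≡ 0
  7∣square≤28⇒≡0 {a} a²≤28 =
    toWitness {a? = allUpTo? (λ a → (7 ∣? a * a) →-dec (a ≟ 0)) 6} _
      {a} (square≤28⇒<6 a²≤28)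

  sum-of-three-squares≢28 : ∀ b c d → b * b + c * c + d * d ≢ 28
  sum-of-three-squares≢28 b c d sum≡28 =
    toWitness {a? = allUpTo? (λ b → allUpTo? (λ c → allUpTo? (λ d →
                      ¬? (b * b + c * c + d * d ≟ 28)) 6) 6) 6} _
      {b} (bound b (≤-trans (m≤m+n (b * b) (c * c)) (m≤m+n _ (d * d))))
      {c} (bound c (≤-trans (m≤n+m (c * c) (b * b)) (m≤m+n _ (d * d))))
      {d} (bound d (m≤n+m (d * d) _))
      sum≡28
    where
    bound : ∀ x → x * x ≤ b * b + c * c + d * d → x < 6
    bound _ x²≤sum = square≤28⇒<6 (≤-trans x²≤sum (≤-reflexive sum≡28))

  sum-of-four-squares≢28 : ∀ a b c d → 7 ∣ a * a → a * a + b * b + c * c + d * d ≢ 28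
  sum-of-four-squares≢28 a b c d 7∣a² sum≡28 =
    sum-of-three-squares≢28 b c d
      (subst (λ a → a * a + b * b + c * c + d * d ≡ 28) a≡0 sum≡28)
    where
    a²≤sum : a * a ≤ a * a + b * b + c * c + d * d
    a²≤sum = ≤-trans (≤-trans (m≤m+n (a * a) (b * b)) (m≤m+n _ (c * c))) (m≤m+n _ (d * d))

    a≡0 : a ≡ 0
    a≡0 = 7∣square≤28⇒≡0 (≤-trans a²≤sum (≤-reflexive sum≡28)) 7∣a²

open SumsOfSquares

open import Data.Nat as ℕ using (ℕ)
open import Data.Nat.Divisibility using (_∣_; m∣m*n; module ∣-Reasoning)
open import Data.Integer using (-[1+_]; -_; _+_; _-_; _*_; ∣_∣)
open import Data.Integer.Properties
  using (+-injective; pos-+; pos-*; abs-*; *-assoc; *-cancelˡ-≡)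
open import Data.Integer.Solver using (module +-*-Solver)
open import Data.Integer.Tactic.RingSolver using (solve)
open import Data.List using (_∷_; [])
open +-*-Solver using (Polynomial; con; _:+_; _:*_; _:-_; :-_; _:=_)

real : ℤ → ℍℤ
real k = ⟨ k , + 0 , + 0 , + 0 ⟩

conj : ℍℤ → ℍℤ
conj ⟨ a , b , c , d ⟩ = ⟨ a , - b , - c , - d ⟩

-- The reflective solver treats p · q as an opaque constant, so quaternion identities are
-- proved with the non-reflective solver, over a copy of the Hamilton product on polynomials.
record ℍPoly (n : ℕ) : Set where
  constructor ⟪_,_,_,_⟫
  field reᴾ iᴾ jᴾ kᴾ : Polynomial n
open ℍPoly

infixl 7 _⊙_
_⊙_ : ∀ {n} → ℍPoly n → ℍPoly n → ℍPoly n
⟪ a₁ , b₁ , c₁ , d₁ ⟫ ⊙ ⟪ a₂ , b₂ , c₂ , d₂ ⟫ =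
  ⟪ a₁ :* a₂ :- b₁ :* b₂ :- c₁ :* c₂ :- d₁ :* d₂
  , a₁ :* b₂ :+ b₁ :* a₂ :+ c₁ :* d₂ :- d₁ :* c₂
  , a₁ :* c₂ :- b₁ :* d₂ :+ c₁ :* a₂ :+ d₁ :* b₂
  , a₁ :* d₂ :+ b₁ :* c₂ :- c₁ :* b₂ :+ d₁ :* a₂ ⟫

normᴾ : ∀ {n} → ℍPoly n → Polynomial n
normᴾ ⟪ a , b , c , d ⟫ = a :* a :+ b :* b :+ c :* c :+ d :* d

conjᴾ : ∀ {n} → ℍPoly n → ℍPoly n
conjᴾ ⟪ a , b , c , d ⟫ = ⟪ a , :- b , :- c , :- d ⟫

realᴾ : ∀ {n} → Polynomial n → ℍPoly n
realᴾ k = ⟪ k , con (+ 0) , con (+ 0) , con (+ 0) ⟫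

norm-· : ∀ p q → norm (p · q) ≡ norm p * norm q
norm-· ⟨ a₁ , b₁ , c₁ , d₁ ⟩ ⟨ a₂ , b₂ , c₂ , d₂ ⟩ =
  +-*-Solver.solve 8 (λ a₁ b₁ c₁ d₁ a₂ b₂ c₂ d₂ →
    let p = ⟪ a₁ , b₁ , c₁ , d₁ ⟫; q = ⟪ a₂ , b₂ , c₂ , d₂ ⟫ in
    normᴾ (p ⊙ q) := normᴾ p :* normᴾ q)
    refl a₁ b₁ c₁ d₁ a₂ b₂ c₂ d₂

re-conj-·-· : ∀ p q s → re (conj p · (p · q · s)) ≡ norm p * re (q · s)
re-conj-·-· ⟨ a₁ , b₁ , c₁ , d₁ ⟩ ⟨ a₂ , b₂ , c₂ , d₂ ⟩ ⟨ a₃ , b₃ , c₃ , d₃ ⟩ =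
  +-*-Solver.solve 12 (λ a₁ b₁ c₁ d₁ a₂ b₂ c₂ d₂ a₃ b₃ c₃ d₃ →
    let p = ⟪ a₁ , b₁ , c₁ , d₁ ⟫; q = ⟪ a₂ , b₂ , c₂ , d₂ ⟫; s = ⟪ a₃ , b₃ , c₃ , d₃ ⟫ in
    reᴾ (conjᴾ p ⊙ (p ⊙ q ⊙ s)) := normᴾ p :* reᴾ (q ⊙ s))
    refl a₁ b₁ c₁ d₁ a₂ b₂ c₂ d₂ a₃ b₃ c₃ d₃

re-·-self : ∀ q → re (q · q) ≡ + 2 * (re q * re q) - norm q
re-·-self ⟨ a , b , c , d ⟩ =
  +-*-Solver.solve 4 (λ a b c d →
    let q = ⟪ a , b , c , d ⟫ in
    reᴾ (q ⊙ q) := con (+ 2) :* (a :* a) :- normᴾ q)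
    refl a b c d

re-conj-·-real : ∀ p k → re (conj p · real k) ≡ re p * k
re-conj-·-real ⟨ a , b , c , d ⟩ k =
  +-*-Solver.solve 5 (λ a b c d k →
    reᴾ (conjᴾ ⟪ a , b , c , d ⟫ ⊙ realᴾ k) := a :* k)
    refl a b c d k

normℕ : ℍℤ → ℕ
normℕ ⟨ a , b , c , d ⟩ =
  ∣ a ∣ ℕ.* ∣ a ∣ ℕ.+ ∣ b ∣ ℕ.* ∣ b ∣ ℕ.+ ∣ c ∣ ℕ.* ∣ c ∣ ℕ.+ ∣ d ∣ ℕ.* ∣ d ∣

i*i≡+∣i∣*∣i∣ : ∀ i → i * i ≡ + (∣ i ∣ ℕ.* ∣ i ∣)
i*i≡+∣i∣*∣i∣ (+ n)    = sym (pos-* n n)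
i*i≡+∣i∣*∣i∣ -[1+ n ] = refl

norm≡+normℕ : ∀ q → norm q ≡ + normℕ q
norm≡+normℕ ⟨ a , b , c , d ⟩
  rewrite i*i≡+∣i∣*∣i∣ a | i*i≡+∣i∣*∣i∣ b | i*i≡+∣i∣*∣i∣ c | i*i≡+∣i∣*∣i∣ d
        | pos-+ (∣ a ∣ ℕ.* ∣ a ∣ ℕ.+ ∣ b ∣ ℕ.* ∣ b ∣ ℕ.+ ∣ c ∣ ℕ.* ∣ c ∣) (∣ d ∣ ℕ.* ∣ d ∣)
        | pos-+ (∣ a ∣ ℕ.* ∣ a ∣ ℕ.+ ∣ b ∣ ℕ.* ∣ b ∣) (∣ c ∣ ℕ.* ∣ c ∣)
        | pos-+ (∣ a ∣ ℕ.* ∣ a ∣) (∣ b ∣ ℕ.* ∣ b ∣)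
        = refl

square≡7[2+x] : ∀ a x → + 4 * (+ 2 * (a * a) - + 28) ≡ x * + 56 → a * a ≡ + 7 * (+ 2 + x)
square≡7[2+x] a x eq = *-cancelˡ-≡ (+ 8) _ _ (begin
  + 8 * (a * a)                         ≡⟨ solve (a ∷ []) ⟩
  + 4 * (+ 2 * (a * a) - + 28) + + 112  ≡⟨ cong (_+ + 112) eq ⟩
  x * + 56 + + 112                      ≡⟨ solve (x ∷ []) ⟩
  + 8 * (+ 7 * (+ 2 + x))               ∎)
  where open ≡-Reasoning

n∣∣a∣*∣a∣ : ∀ {n x} a → a * a ≡ + n * x → n ∣ ∣ a ∣ ℕ.* ∣ a ∣
n∣∣a∣*∣a∣ {n} {x} a a²≡n*x = begin
  n                ∣⟨ m∣m*n ∣ x ∣ ⟩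
  n ℕ.* ∣ x ∣      ≡⟨ abs-* (+ n) x ⟨
  ∣ + n * x ∣      ≡⟨ cong ∣_∣ a²≡n*x ⟨
  ∣ a * a ∣        ≡⟨ abs-* a a ⟩
  ∣ a ∣ ℕ.* ∣ a ∣  ∎
  where open ∣-Reasoning

module _ (u r : ℍℤ) (norm-u≡4 : norm u ≡ + 4) (u·r·r≡56 : u · r · r ≡ real (+ 56)) where
  open ≡-Reasoning

  normℕ≡28 : normℕ r ≡ 28
  normℕ≡28 = square-injective (+-injective (begin
    + (normℕ r ℕ.* normℕ r)  ≡⟨ pos-* (normℕ r) (normℕ r) ⟩
    + normℕ r * + normℕ r    ≡⟨ cong₂ _*_ (sym (norm≡+normℕ r)) (sym (norm≡+normℕ r)) ⟩
    norm r * norm r          ≡⟨ *-cancelˡ-≡ (+ 4) _ _ 4*norm²≡3136 ⟩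
    + 28 * + 28              ∎))
    where
    4*norm²≡3136 : + 4 * (norm r * norm r) ≡ + 3136
    4*norm²≡3136 = begin
      + 4 * (norm r * norm r)     ≡⟨ cong (_* (norm r * norm r)) norm-u≡4 ⟨
      norm u * (norm r * norm r)  ≡⟨ *-assoc (norm u) (norm r) (norm r) ⟨
      norm u * norm r * norm r    ≡⟨ cong (_* norm r) (norm-· u r) ⟨
      norm (u · r) * norm r       ≡⟨ norm-· (u · r) r ⟨
      norm (u · r · r)            ≡⟨ cong norm u·r·r≡56 ⟩
      + 3136                      ∎

  re²≡7[2+re-u] : re r * re r ≡ + 7 * (+ 2 + re u)
  re²≡7[2+re-u] = square≡7[2+x] (re r) (re u) 4*re[r²]≡re-u*56
    where
    norm-r≡28 : norm r ≡ + 28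
    norm-r≡28 = trans (norm≡+normℕ r) (cong +_ normℕ≡28)

    4*re[r²]≡re-u*56 : + 4 * (+ 2 * (re r * re r) - + 28) ≡ re u * + 56
    4*re[r²]≡re-u*56 = begin
      + 4 * (+ 2 * (re r * re r) - + 28)
        ≡⟨ cong₂ (λ m n → m * (+ 2 * (re r * re r) - n)) norm-u≡4 norm-r≡28 ⟨
      norm u * (+ 2 * (re r * re r) - norm r)  ≡⟨ cong (norm u *_) (re-·-self r) ⟨
      norm u * re (r · r)                      ≡⟨ re-conj-·-· u r r ⟨
      re (conj u · (u · r · r))                ≡⟨ cong (λ x → re (conj u · x)) u·r·r≡56 ⟩
      re (conj u · real (+ 56))                ≡⟨ re-conj-·-real u (+ 56) ⟩
      re u * + 56                              ∎

no-solution : ∀ u r → norm u ≡ + 4 → u · r · r ≡ real (+ 56) → ⊥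
no-solution u r@(⟨ a , b , c , d ⟩) norm-u≡4 u·r·r≡56 =
  sum-of-four-squares≢28 (∣ a ∣) (∣ b ∣) (∣ c ∣) (∣ d ∣)
    (n∣∣a∣*∣a∣ a (re²≡7[2+re-u] u r norm-u≡4 u·r·r≡56))
    (normℕ≡28 u r norm-u≡4 u·r·r≡56)

mainTheorem4 :
    (norm ⟨ + 7 , + 0 , + 0 , + 0 ⟩ ≡ + 49)
    × ¬ (Σ ℍℤ λ u → Σ ℍℤ λ r →
           IsUnitDouble u × IsHurwitzDouble r
           × u · r · r ≡ scale (+ 8) ⟨ + 7 , + 0 , + 0 , + 0 ⟩)
mainTheorem4 =
  refl , λ { (u , r , (_ , norm-u≡4) , _ , u·r·r≡56) → no-solution u r norm-u≡4 u·r·r≡56 }
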